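{- Let $\gamma:\Gamma\vdash\varphi(\gamma):\mathrm{Cof}$, $\gamma:\Gamma,u:\varphi(\gamma)\vdash A(u)$, $\gamma:\Gamma\vdash B(\gamma)$ and $\gamma:\Gamma,u:\varphi(\gamma)\vdash f(u):A(u)\to B$. If $A$ and $B$ are fibrations and each $f(u)$ is an equivalence, then $\gamma:\Gamma\vdash\mathrm{Glue}(\varphi(\gamma),f)$ has a fibration structure which is preserved by the canonical isomorphism $\Gamma,u:\varphi\vdash e(u):\mathrm{Glue}(\varphi,f)\cong A(u)$ (i.e. $e(u)$ carries the composition operation of $\mathrm{Glue}$ to that of $A$ whenever $\varphi$ holds).
   Context: Let $\mathcal E$ be a model of extensional dependent type theory (category with families) with dependent products, dependent sums, extensional identity types, unit type, disjoint finite coproducts and propositional truncation; we use its internal language. Propositions are types any two of whose elements are equal; $\bot,\top,\wedge,\forall$ denote $\mathbf0,\mathbf1,\times,\prod$ on propositions, $\varphi\lor\psi:=\|\varphi+\psi\|$, $\{x:A\mid\varphi\}:=\sum_{x:A}\varphi$; $\mathbf 2:=\mathbf1+\mathbf1$ with $\bar0=1,\bar1=0$. A dependent right adjoint to a functor $H$ on contexts assigns to each context $\Gamma$ and type $A$ over $H\Gamma$ a type $G_\Gamma A$ over $\Gamma$ with a reindexing-stable bijection between terms of $A$ over $H\Gamma$ and of $G_\Gamma A$ over $\Gamma$. $\mathcal E$ is equipped with a closed type $\mathbb I$, $0,1:\mathbb I$, binary operations $\sqcap,\sqcup$, a dependent right adjoint to $(\mathbb I\to-)$, and a propositional universe $\mathrm{Cof}$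 (type with a family of propositions; we identify codes with propositions), satisfying: (1) $\neg(0=1)$; (2) $0\sqcap i=i\sqcap0=0$, $1\sqcap i=i\sqcap1=i$; (3) $0\sqcup i=i\sqcup0=i$, $1\sqcup i=i\sqcup1=1$; (4),(5) $i=0$, $i=1$ have codes in $\mathrm{Cof}$; (6) $\mathrm{Cof}$ closed under $\lor$; (7) closed under $\sum_{u:\varphi}\psi u$ for $\psi:\varphi\to\mathrm{Cof}$; (8) closed under $\forall_{i:\mathbb I}$; (9) $(\varphi\leftrightarrow\psi)\to\varphi=\psi$ for $\varphi,\psi:\mathrm{Cof}$. Regard $\mathbf 2\subseteq\mathbb I$ via end-points. For $\Gamma,i:\mathbb I\vdash A(i)$: $\mathrm{Comp}^i(A(i)):=\prod_{e:\mathbf 2}\prod_{\varphi:\mathrm{Cof}}\prod_{f:\varphi\to\prod_{i}A(i)}\prod_{a:A(e)}(\forall_{u:\varphi}fue=a)\to\{a':A(\bar e)\mid\forall_{u:\varphi}fu\bar e=a'\}$; for $\gamma:\Gamma\vdash A(\gamma)$: $\mathrm{Fib}(A):=\prod_{p:\mathbb I\to\Gamma}\mathrm{Comp}^i(A(pi))$; a fibration is a type with a global element of $\mathrm{Fib}(A)$ (for a dependent type over $\Gamma,u:\varphi$, the base is the context $\sum_{\gamma}\varphi(\gamma)$). $\mathrm{Path}(A,a_0,a_1):=\{p:\mathbb I\to A\mid p0=a_0\wedge p1=a_1\}$. A map $f:A\to B$ of fibrations is an equivalence if for each $b:B$ the fiber $\sum_{a:A}\mathrm{Path}(B,b,fa)$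 is contractible (has an element $c$ with a path from $c$ to every element). For a proposition $\varphi$, types $\Gamma,u:\varphi\vdash A(u)$, $\Gamma\vdash B$ and $f(u):A(u)\to B$: $\mathrm{Glue}(\varphi,f):=\sum_{a:\prod_{u:\varphi}A(u)}\{b:B\mid\forall_{u:\varphi}f(u)(au)=b\}$, and $e(u):=\lambda(a,b).au:\mathrm{Glue}(\varphi,f)\cong A(u)$ (inverse $\lambda a.(\lambda v.a,f(u)a)$). -}

module Defs where

open import Data.Bool using (Bool; true; false; not)
open import Data.Empty using (⊥)
open import Data.Product using (Σ; _×_; _,_; proj₁; proj₂)
open import Data.Sum using (_⊎_)
open import Relation.Nullary using (¬_)
open import Relation.Binary.PropositionalEquality using (_≡_; cong)

-- Shallow embedding of the internal language of 𝓔 into Agda's Set.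
-- Π, Σ, 1, finite coproducts are Agda's own; extensionality of identity
-- types is provided by the fields funext and uip; propositional truncation
-- is an axiomatised structure.

isProp : Set → Set
isProp P = (x y : P) → x ≡ y

record Model : Set₁ where
  field
    funext : {A : Set} {B : A → Set} {f g : (x : A) → B x} →
             ((x : A) → f x ≡ g x) → f ≡ g
    uip    : {A : Set} {x y : A} (p q : x ≡ y) → p ≡ q
    ∥_∥      : Set → Set
    ∣_∣      : {A : Set} → A → ∥ A ∥
    ∥∥-prop  : {A : Set} → isProp ∥ A ∥
    ∥∥-elim  : {A P : Set} → isProp P → (A → P) → ∥ A ∥ → P
    𝕀   : Set
    O   : 𝕀
    I1  : 𝕀
    _⊓_ : 𝕀 → 𝕀 → 𝕀
    _⊔_ : 𝕀 → 𝕀 → 𝕀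
    Cof     : Set
    [_]     : Cof → Set
    [_]-prop : (φ : Cof) → isProp [ φ ]
    O≠I1 : ¬ (O ≡ I1)
    O⊓ : (i : 𝕀) → O ⊓ i ≡ O
    ⊓O : (i : 𝕀) → i ⊓ O ≡ O
    I1⊓ : (i : 𝕀) → I1 ⊓ i ≡ i
    ⊓I1 : (i : 𝕀) → i ⊓ I1 ≡ i
    O⊔ : (i : 𝕀) → O ⊔ i ≡ i
    ⊔O : (i : 𝕀) → i ⊔ O ≡ i
    I1⊔ : (i : 𝕀) → I1 ⊔ i ≡ I1
    ⊔I1 : (i : 𝕀) → i ⊔ I1 ≡ I1
    _≈O     : 𝕀 → Cof
    ≈O-in   : (i : 𝕀) → i ≡ O → [ i ≈O ]
    ≈O-out  : (i : 𝕀) → [ i ≈O ] → i ≡ O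
    _≈I1    : 𝕀 → Cof
    ≈I1-in  : (i : 𝕀) → i ≡ I1 → [ i ≈I1 ]
    ≈I1-out : (i : 𝕀) → [ i ≈I1 ] → i ≡ I1
    _∨_    : Cof → Cof → Cof
    ∨-in   : (φ ψ : Cof) → ∥ [ φ ] ⊎ [ ψ ] ∥ → [ φ ∨ ψ ]
    ∨-out  : (φ ψ : Cof) → [ φ ∨ ψ ] → ∥ [ φ ] ⊎ [ ψ ] ∥
    cofΣ     : (φ : Cof) → ([ φ ] → Cof) → Cof
    cofΣ-in  : (φ : Cof) (ψ : [ φ ] → Cof) → Σ [ φ ] (λ u → [ ψ u ]) → [ cofΣ φ ψ ]
    cofΣ-out : (φ : Cof) (ψ : [ φ ] → Cof) → [ cofΣ φ ψ ] → Σ [ φ ] (λ u → [ ψ u ])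
    cof∀     : (𝕀 → Cof) → Cof
    cof∀-in  : (φ : 𝕀 → Cof) → ((i : 𝕀) → [ φ i ]) → [ cof∀ φ ]
    cof∀-out : (φ : 𝕀 → Cof) → [ cof∀ φ ] → (i : 𝕀) → [ φ i ]
    cofext : (φ ψ : Cof) → ([ φ ] → [ ψ ]) → ([ ψ ] → [ φ ]) → φ ≡ ψ

module Internal (𝓜 : Model) where
  open Model 𝓜 public

  -- 𝟐 ⊆ 𝕀 via end-points (false ↦ 0, true ↦ 1); ē = not e
  ⟨_⟩ : Bool → 𝕀
  ⟨ false ⟩ = O
  ⟨ true ⟩  = I1

  Comp : (𝕀 → Set) → Set
  Comp A = (e : Bool) (φ : Cof) (f : [ φ ] → (i : 𝕀) → A i) (a : A ⟨ e ⟩) →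
           ((u : [ φ ]) → f u ⟨ e ⟩ ≡ a) →
           Σ (A ⟨ not e ⟩) (λ a' → (u : [ φ ]) → f u ⟨ not e ⟩ ≡ a')

  Fib : {Γ : Set} → (Γ → Set) → Set
  Fib {Γ} A = (p : 𝕀 → Γ) → Comp (λ i → A (p i))

  Path : (A : Set) → A → A → Set
  Path A a₀ a₁ = Σ (𝕀 → A) (λ p → (p O ≡ a₀) × (p I1 ≡ a₁))

  isContr : Set → Set
  isContr X = Σ X (λ c → (x : X) → Path X c x)

  isEquiv : {A B : Set} → (A → B) → Set
  isEquiv {A} {B} f = (b : B) → isContr (Σ A (λ a → Path B b (f a)))

  Glue : {Γ : Set} (φ : Γ → Cof) (A : (γ : Γ) → [ φ γ ] → Set) (B : Γ → Set)
         (f : (γ : Γ) (u : [ φ γ ]) → A γ u → B γ) → Γ → Set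
  Glue φ A B f γ =
    Σ ((u : [ φ γ ]) → A γ u) (λ a → Σ (B γ) (λ b → (u : [ φ γ ]) → f γ u (a u) ≡ b))

  unglueA : {Γ : Set} (φ : Γ → Cof) (A : (γ : Γ) → [ φ γ ] → Set) (B : Γ → Set)
            (f : (γ : Γ) (u : [ φ γ ]) → A γ u → B γ) (γ : Γ) (u : [ φ γ ]) →
            Glue φ A B f γ → A γ u
  unglueA φ A B f γ u g = proj₁ g u

  -- e(u) carries the composition structure αG of Glue to the structure αA of A
  -- (over Γ,u:φ, whose base is the context Σ Γ φ)
  Preserves : {Γ : Set} (φ : Γ → Cof) (A : (γ : Γ) → [ φ γ ] → Set) (B : Γ → Set)
              (f : (γ : Γ) (u : [ φ γ ]) → A γ u → B γ) →
              Fib (Glue φ A B f) →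
              Fib {Σ Γ (λ γ → [ φ γ ])} (λ x → A (proj₁ x) (proj₂ x)) → Set
  Preserves {Γ} φ A B f αG αA =
    (p : 𝕀 → Σ Γ (λ γ → [ φ γ ])) (e : Bool) (ψ : Cof)
    (g : [ ψ ] → (i : 𝕀) → Glue φ A B f (proj₁ (p i)))
    (a : Glue φ A B f (proj₁ (p ⟨ e ⟩)))
    (h : (v : [ ψ ]) → g v ⟨ e ⟩ ≡ a) →
    unglueA φ A B f (proj₁ (p ⟨ not e ⟩)) (proj₂ (p ⟨ not e ⟩))
      (proj₁ (αG (λ i → proj₁ (p i)) e ψ g a h))
      ≡ proj₁ (αA p e ψ
                 (λ v i → unglueA φ A B f (proj₁ (p i)) (proj₂ (p i)) (g v i))
                 (unglueA φ A B f (proj₁ (p ⟨ e ⟩)) (proj₂ (p ⟨ e ⟩)) a)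
                 (λ v → cong (unglueA φ A B f (proj₁ (p ⟨ e ⟩)) (proj₂ (p ⟨ e ⟩))) (h v)))

-- The composition of Glue is the one of Cohen, Coquand, Huber and Mörtberg. First compose in B
-- over ψ ∨ (φ along the whole path), using f of a filler in A on the second face. At the target,
-- over each u : φ, the given lids and (if φ holds along the path) the A-composition are partial
-- elements with constant path of the fibre of f u over the resulting b₀. That fibre is fibrant,
-- and contractible because f u is an equivalence, so they extend to a total element (a₁, b₀ ⇝ f a₁);
-- a last composition in B along its path moves b₀ to a B-component matching a₁. When φ holds
-- along the whole path, a₁ is the A-composition, which is the preservation property.

module Submission where

open import Defs
open import Data.Bool using (Bool; true; false; not)
open import Data.Empty using (⊥-elim)
open import Data.Product using (Σ; _,_; proj₁; proj₂)
open import Data.Sum using (_⊎_; inj₁; inj₂)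
open import Function using (id)
open import Relation.Nullary using (¬_)
open import Relation.Binary.PropositionalEquality
  using (_≡_; _≢_; refl; sym; trans; cong; cong₂; cong-app; subst; module ≡-Reasoning)
open import Relation.Binary.PropositionalEquality.Properties using (dcong; dcong₂; subst-subst)

module GlueFibrancy (𝓜 : Model) where
  open Internal 𝓜

  subst-irrelevant : {X : Set} (C : X → Set) {x y : X} (p q : x ≡ y) (c : C x) →
                     subst C p c ≡ subst C q c
  subst-irrelevant C p q c = cong (λ r → subst C r c) (uip p q)

  subst-loop : {X : Set} (C : X → Set) {x : X} (q : x ≡ x) (c : C x) → subst C q c ≡ c
  subst-loop C q = subst-irrelevant C q refl

  subst-dcong : {W Y : Set} (P : Y → Set) (h : W → Y) (F : (w : W) → P (h w)) {w w' : W} →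
                w ≡ w' → (q : h w ≡ h w') → subst P q (F w) ≡ F w'
  subst-dcong P h F {w} refl q = subst-loop P q (F w)

  ∨-inl : {φ ψ : Cof} → [ φ ] → [ φ ∨ ψ ]
  ∨-inl {φ} {ψ} u = ∨-in φ ψ ∣ inj₁ u ∣

  ∨-inr : {φ ψ : Cof} → [ ψ ] → [ φ ∨ ψ ]
  ∨-inr {φ} {ψ} v = ∨-in φ ψ ∣ inj₂ v ∣

  ∨-identityʳ : {φ ψ : Cof} → ¬ [ ψ ] → φ ∨ ψ ≡ φ
  ∨-identityʳ {φ} {ψ} ¬ψ = cofext (φ ∨ ψ) φ resolve ∨-inl
    where
      resolve : [ φ ∨ ψ ] → [ φ ]
      resolve w = ∥∥-elim ([ φ ]-prop) (λ { (inj₁ u) → u ; (inj₂ v) → ⊥-elim (¬ψ v) })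
                          (∨-out φ ψ w)

  module Join {X : Set} {φ ψ : Cof} (f : [ φ ] → X) (g : [ ψ ] → X)
              (agree : (u : [ φ ]) (v : [ ψ ]) → f u ≡ g v) where

    -- Bound is a proposition under φ ∨ ψ, so the truncation in ∨-out can be eliminated into it.
    private
      Bound : Set
      Bound = Σ X (λ x → Σ ((u : [ φ ]) → f u ≡ x) (λ _ → (v : [ ψ ]) → g v ≡ x))

      Bound-unique : ∥ [ φ ] ⊎ [ ψ ] ∥ → isProp Bound
      Bound-unique t (x , fx , gx) (y , fy , gy)
        with ∥∥-elim uip (λ { (inj₁ u) → trans (sym (fx u)) (fy u)
                            ; (inj₂ v) → trans (sym (gx v)) (gy v) }) t
      ... | refl = cong (x ,_) (cong₂ _,_ (funext (λ _ → uip _ _)) (funext (λ _ → uip _ _)))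

      bound : [ φ ∨ ψ ] → Bound
      bound w = ∥∥-elim (Bound-unique (∨-out φ ψ w))
        (λ { (inj₁ u) → f u , (λ u' → cong f ([ φ ]-prop u' u)) , (λ v → sym (agree u v))
           ; (inj₂ v) → g v , (λ u → agree u v) , (λ v' → cong g ([ ψ ]-prop v' v)) })
        (∨-out φ ψ w)

    join : [ φ ∨ ψ ] → X
    join w = proj₁ (bound w)

    join-≡ : {Y : Set} (F : X → Y) {y : Y} → ((u : [ φ ]) → F (f u) ≡ y) →
             ((v : [ ψ ]) → F (g v) ≡ y) → (w : [ φ ∨ ψ ]) → F (join w) ≡ y
    join-≡ F Ff Fg w = ∥∥-elim uip
      (λ { (inj₁ u) → trans (cong F (sym (proj₁ (proj₂ (bound w)) u))) (Ff u)
         ; (inj₂ v) → trans (cong F (sym (proj₂ (proj₂ (bound w)) v))) (Fg v) })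
      (∨-out φ ψ w)

    restrictˡ : {Y : Set} (F : X → Y) {y : Y} → ((w : [ φ ∨ ψ ]) → F (join w) ≡ y) →
                (u : [ φ ]) → F (f u) ≡ y
    restrictˡ F Fj u = trans (cong F (proj₁ (proj₂ (bound (∨-inl u))) u)) (Fj (∨-inl u))

    restrictʳ : {Y : Set} (F : X → Y) {y : Y} → ((w : [ φ ∨ ψ ]) → F (join w) ≡ y) →
                (v : [ ψ ]) → F (g v) ≡ y
    restrictʳ F Fj v = trans (cong F (proj₂ (proj₂ (bound (∨-inr v))) v)) (Fj (∨-inr v))

  _≈⟨_⟩ : 𝕀 → Bool → Cof
  i ≈⟨ false ⟩ = i ≈O
  i ≈⟨ true ⟩  = i ≈I1

  ≈⟨⟩-in : (i : 𝕀) (e : Bool) → i ≡ ⟨ e ⟩ → [ i ≈⟨ e ⟩ ]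
  ≈⟨⟩-in i false = ≈O-in i
  ≈⟨⟩-in i true  = ≈I1-in i

  ≈⟨⟩-out : (i : 𝕀) (e : Bool) → [ i ≈⟨ e ⟩ ] → i ≡ ⟨ e ⟩
  ≈⟨⟩-out i false = ≈O-out i
  ≈⟨⟩-out i true  = ≈I1-out i

  ⟨not⟩≢⟨⟩ : (e : Bool) → ⟨ not e ⟩ ≢ ⟨ e ⟩
  ⟨not⟩≢⟨⟩ false q = O≠I1 (sym q)
  ⟨not⟩≢⟨⟩ true  q = O≠I1 q

  conn : Bool → 𝕀 → 𝕀 → 𝕀
  conn false = _⊓_
  conn true  = _⊔_

  conn-zeroˡ : (e : Bool) (j : 𝕀) → conn e ⟨ e ⟩ j ≡ ⟨ e ⟩
  conn-zeroˡ false = O⊓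
  conn-zeroˡ true  = I1⊔

  conn-zeroʳ : (e : Bool) (i : 𝕀) → conn e i ⟨ e ⟩ ≡ ⟨ e ⟩
  conn-zeroʳ false = ⊓O
  conn-zeroʳ true  = ⊔I1

  conn-identityˡ : (e : Bool) (j : 𝕀) → conn e ⟨ not e ⟩ j ≡ j
  conn-identityˡ false = I1⊓
  conn-identityˡ true  = O⊔

  conn-identityʳ : (e : Bool) (i : 𝕀) → conn e i ⟨ not e ⟩ ≡ i
  conn-identityʳ false = ⊓I1
  conn-identityʳ true  = ⊔O

  reindex : {Γ Δ : Set} {A : Γ → Set} → Fib A → (σ : Δ → Γ) → Fib (λ x → A (σ x))
  reindex α σ p = α (λ i → σ (p i))

  comp-cong : {C : 𝕀 → Set} (α : Fib C) (e : Bool) {r r' : 𝕀 → 𝕀} (r≡r' : r ≡ r')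
              {ψ ψ' : Cof} → ψ ≡ ψ' →
              {g : [ ψ ] → (j : 𝕀) → C (r j)} {g' : [ ψ' ] → (j : 𝕀) → C (r' j)}
              {a : C (r ⟨ e ⟩)} {a' : C (r' ⟨ e ⟩)}
              (h : (v : [ ψ ]) → g v ⟨ e ⟩ ≡ a) (h' : (v : [ ψ' ]) → g' v ⟨ e ⟩ ≡ a') →
              ((v : [ ψ ]) (v' : [ ψ' ]) (j : 𝕀) → subst C (cong-app r≡r' j) (g v j) ≡ g' v' j) →
              subst C (cong-app r≡r' ⟨ e ⟩) a ≡ a' →
              subst C (cong-app r≡r' ⟨ not e ⟩) (proj₁ (α r e ψ g a h)) ≡ proj₁ (α r' e ψ' g' a' h')
  comp-cong α e {r} refl {ψ} refl {g} h h' g≡g' refl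
    with funext (λ v → funext (g≡g' v v))
  ... | refl = cong (λ h → proj₁ (α r e ψ g _ h)) (funext (λ v → uip (h v) (h' v)))

  module Filling {C : 𝕀 → Set} (α : Fib C) (e : Bool) (ψ : Cof) (g : [ ψ ] → (i : 𝕀) → C i)
                 (a : C ⟨ e ⟩) (h : (v : [ ψ ]) → g v ⟨ e ⟩ ≡ a) where

    comp : Σ (C ⟨ not e ⟩) (λ a' → (v : [ ψ ]) → g v ⟨ not e ⟩ ≡ a')
    comp = α id e ψ g a h

    -- The filler at i composes along j ↦ conn e i j, adding the face i = ⟨ e ⟩ where that
    -- path is constant.
    private
      module At (i : 𝕀) where
        from-end : [ i ≈⟨ e ⟩ ] → (j : 𝕀) → ⟨ e ⟩ ≡ conn e i j
        from-end w j = sym (trans (cong (λ k → conn e k j) (≈⟨⟩-out i e w)) (conn-zeroˡ e j))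

        module Tube = Join {φ = ψ} {ψ = i ≈⟨ e ⟩}
          (λ v j → g v (conn e i j)) (λ w j → subst C (from-end w j) a)
          (λ v w → funext (λ j → trans (sym (dcong (g v) (from-end w j)))
                                       (cong (subst C (from-end w j)) (h v))))

        base : C (conn e i ⟨ e ⟩)
        base = subst C (sym (conn-zeroʳ e i)) a

        base-agrees : (w : [ ψ ∨ (i ≈⟨ e ⟩) ]) → Tube.join w ⟨ e ⟩ ≡ base
        base-agrees = Tube.join-≡ (λ x → x ⟨ e ⟩)
          (λ v → trans (sym (dcong (g v) (sym (conn-zeroʳ e i))))
                       (cong (subst C (sym (conn-zeroʳ e i))) (h v)))
          (λ w → subst-irrelevant C (from-end w ⟨ e ⟩) (sym (conn-zeroʳ e i)) a)

        result : Σ (C (conn e i ⟨ not e ⟩))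
                   (λ c → (w : [ ψ ∨ (i ≈⟨ e ⟩) ]) → Tube.join w ⟨ not e ⟩ ≡ c)
        result = α (conn e i) e (ψ ∨ (i ≈⟨ e ⟩)) Tube.join base base-agrees

    fill : (i : 𝕀) → C i
    fill i = subst C (conn-identityʳ e i) (proj₁ (At.result i))

    fill-agree : (v : [ ψ ]) (i : 𝕀) → g v i ≡ fill i
    fill-agree v i = trans (sym (dcong (g v) (conn-identityʳ e i)))
      (cong (subst C (conn-identityʳ e i))
            (At.Tube.restrictˡ i (λ x → x ⟨ not e ⟩) (proj₂ (At.result i)) v))

    fill-e : fill ⟨ e ⟩ ≡ a
    fill-e = begin
      subst C (conn-identityʳ e ⟨ e ⟩) (proj₁ result)
        ≡⟨ cong (subst C (conn-identityʳ e ⟨ e ⟩))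
                (sym (Tube.restrictʳ (λ x → x ⟨ not e ⟩) (proj₂ result) at-e)) ⟩
      subst C (conn-identityʳ e ⟨ e ⟩) (subst C (from-end at-e ⟨ not e ⟩) a)
        ≡⟨ subst-subst (from-end at-e ⟨ not e ⟩) ⟩
      subst C (trans (from-end at-e ⟨ not e ⟩) (conn-identityʳ e ⟨ e ⟩)) a
        ≡⟨ subst-loop C _ a ⟩
      a ∎
      where
        open ≡-Reasoning
        open At ⟨ e ⟩
        at-e : [ ⟨ e ⟩ ≈⟨ e ⟩ ]
        at-e = ≈⟨⟩-in ⟨ e ⟩ e refl

    fill-not-e : fill ⟨ not e ⟩ ≡ proj₁ comp
    fill-not-e =
      trans (subst-irrelevant C (conn-identityʳ e ⟨ not e ⟩) (cong-app conn≡id ⟨ not e ⟩) _)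
      (comp-cong α e conn≡id (∨-identityʳ not-at-e) base-agrees h tube≡g base≡a)
      where
        open At ⟨ not e ⟩
        conn≡id : conn e ⟨ not e ⟩ ≡ id
        conn≡id = funext (conn-identityˡ e)
        not-at-e : ¬ [ ⟨ not e ⟩ ≈⟨ e ⟩ ]
        not-at-e w = ⟨not⟩≢⟨⟩ e (≈⟨⟩-out ⟨ not e ⟩ e w)
        tube≡g : (w : [ ψ ∨ (⟨ not e ⟩ ≈⟨ e ⟩) ]) (v : [ ψ ]) (j : 𝕀) →
                 subst C (cong-app conn≡id j) (Tube.join w j) ≡ g v j
        tube≡g w v j = Tube.join-≡ (λ x → subst C (cong-app conn≡id j) (x j))
          (λ v' → trans (dcong (g v') (cong-app conn≡id j)) (cong (λ z → g z j) ([ ψ ]-prop v' v)))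
          (λ w' → ⊥-elim (not-at-e w')) w
        base≡a : subst C (cong-app conn≡id ⟨ e ⟩) base ≡ a
        base≡a = trans (subst-subst (sym (conn-zeroʳ e ⟨ not e ⟩)) {cong-app conn≡id ⟨ e ⟩})
                       (subst-loop C _ a)

  Fiber : {X Y : Set} → (X → Y) → Y → Set
  Fiber {X} {Y} f y = Σ X (λ x → Path Y y (f x))

  Fiber-≡ : {X Y : Set} {f : X → Y} {y : Y} {x x' : X} {p p' : 𝕀 → Y}
            {s : p O ≡ y} {t : p I1 ≡ f x} {s' : p' O ≡ y} {t' : p' I1 ≡ f x'} →
            x ≡ x' → p ≡ p' → _≡_ {A = Fiber f y} (x , p , s , t) (x' , p' , s' , t')
  Fiber-≡ refl refl = cong₂ (λ s t → _ , _ , s , t) (uip _ _) (uip _ _)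

  const-fiber : {X Y : Set} {f : X → Y} {y : Y} (x : X) → y ≡ f x → Fiber f y
  const-fiber {y = y} x q = x , (λ _ → y) , refl , q

  ∂ : 𝕀 → Cof
  ∂ k = (k ≈O) ∨ (k ≈I1)

  module Boundary {X : Set} (k : 𝕀) (x₀ x₁ : X) =
    Join {φ = k ≈O} {ψ = k ≈I1} (λ _ → x₀) (λ _ → x₁)
    (λ z z' → ⊥-elim (O≠I1 (trans (sym (≈O-out k z)) (≈I1-out k z'))))

  path-at-O : {Y : Set} {y₀ y₁ : Y} (q : Path Y y₀ y₁) {k : 𝕀} → [ k ≈O ] → proj₁ q k ≡ y₀
  path-at-O q {k} z = trans (cong (proj₁ q) (≈O-out k z)) (proj₁ (proj₂ q))

  path-at-I1 : {Y : Set} {y₀ y₁ : Y} (q : Path Y y₀ y₁) {k : 𝕀} → [ k ≈I1 ] → proj₁ q k ≡ y₁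
  path-at-I1 q {k} z = trans (cong (proj₁ q) (≈I1-out k z)) (proj₂ (proj₂ q))

  fiber-comp : {X Y : Set} (f : X → Y) (y : Y) → Comp (λ _ → X) → Comp (λ _ → Y) →
               Comp (λ _ → Fiber f y)
  fiber-comp {X} {Y} f y cX cY e ψ g x h =
    (FillX.fill ⟨ not e ⟩ , π , π-O , π-I1) ,
    (λ v → Fiber-≡ (FillX.fill-agree v ⟨ not e ⟩)
                   (funext (λ k → At.Tube.restrictˡ k (λ q → q ⟨ not e ⟩) (proj₂ (At.result k)) v)))
    where
      path : Fiber f y → 𝕀 → Y
      path z = proj₁ (proj₂ z)

      module FillX = Filling {C = λ _ → X} (λ _ → cX) e ψ (λ v j → proj₁ (g v j)) (proj₁ x)
                             (λ v → cong proj₁ (h v))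

      module At (k : 𝕀) where
        module Ends = Boundary k (λ (_ : 𝕀) → y) (λ j → f (FillX.fill j))

        ends-agree : (v : [ ψ ]) (w : [ ∂ k ]) → Ends.join w ≡ (λ j → path (g v j) k)
        ends-agree v = Ends.join-≡ id
          (λ z → funext (λ j → sym (path-at-O (proj₂ (g v j)) z)))
          (λ z → funext (λ j → trans (cong f (sym (FillX.fill-agree v j)))
                                     (sym (path-at-I1 (proj₂ (g v j)) z))))

        module Tube = Join (λ v j → path (g v j) k) Ends.join (λ v w → sym (ends-agree v w))

        base-agrees : (w : [ ψ ∨ ∂ k ]) → Tube.join w ⟨ e ⟩ ≡ path x k
        base-agrees = Tube.join-≡ (λ q → q ⟨ e ⟩)
          (λ v → cong (λ z → path z k) (h v))
          (Ends.join-≡ (λ q → q ⟨ e ⟩)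
            (λ z → sym (path-at-O (proj₂ x) z))
            (λ z → trans (cong f FillX.fill-e) (sym (path-at-I1 (proj₂ x) z))))

        result : Σ Y (λ b → (w : [ ψ ∨ ∂ k ]) → Tube.join w ⟨ not e ⟩ ≡ b)
        result = cY e (ψ ∨ ∂ k) Tube.join (path x k) base-agrees

        result-on-∂ : (w : [ ∂ k ]) → Ends.join w ⟨ not e ⟩ ≡ proj₁ result
        result-on-∂ = Tube.restrictʳ (λ q → q ⟨ not e ⟩) (proj₂ result)

      π : 𝕀 → Y
      π k = proj₁ (At.result k)

      π-O : π O ≡ y
      π-O = sym (At.Ends.restrictˡ O (λ q → q ⟨ not e ⟩) (At.result-on-∂ O) (≈O-in O refl))

      π-I1 : π I1 ≡ f (FillX.fill ⟨ not e ⟩)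
      π-I1 = sym (At.Ends.restrictʳ I1 (λ q → q ⟨ not e ⟩) (At.result-on-∂ I1) (≈I1-in I1 refl))

  isContr→extension : {X : Set} → isContr X → Comp (λ _ → X) → (χ : Cof) (x : [ χ ] → X) →
                      Σ X (λ x' → (w : [ χ ]) → x w ≡ x')
  isContr→extension {X} (c , contraction) cX χ x =
    proj₁ result , λ w → trans (sym (proj₂ (proj₂ (contraction (x w))))) (proj₂ result w)
    where
      result : Σ X (λ x' → (w : [ χ ]) → proj₁ (contraction (x w)) I1 ≡ x')
      result = cX false χ (λ w → proj₁ (contraction (x w))) c
                  (λ w → proj₁ (proj₂ (contraction (x w))))

  module GlueFib {Γ : Set} (φ : Γ → Cof) (A : (γ : Γ) → [ φ γ ] → Set) (B : Γ → Set)
                 (f : (γ : Γ) (u : [ φ γ ]) → A γ u → B γ)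
                 (αA : Fib {Σ Γ (λ γ → [ φ γ ])} (λ x → A (proj₁ x) (proj₂ x)))
                 (αB : Fib B) (f-equiv : (γ : Γ) (u : [ φ γ ]) → isEquiv (f γ u)) where

    unglue : {γ : Γ} → Glue φ A B f γ → B γ
    unglue x = proj₁ (proj₂ x)

    unglue-on-φ : {γ : Γ} (x : Glue φ A B f γ) (u : [ φ γ ]) → f γ u (proj₁ x u) ≡ unglue x
    unglue-on-φ x = proj₂ (proj₂ x)

    Glue-≡ : {γ : Γ} {a a' : (u : [ φ γ ]) → A γ u} {b b' : B γ}
             {c : (u : [ φ γ ]) → f γ u (a u) ≡ b} {c' : (u : [ φ γ ]) → f γ u (a' u) ≡ b'} →
             a ≡ a' → b ≡ b' → _≡_ {A = Glue φ A B f γ} (a , b , c) (a' , b' , c')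
    Glue-≡ refl refl = cong (λ c → _ , _ , c) (funext (λ _ → uip _ _))

    module Composition (p : 𝕀 → Γ) (e : Bool) (ψ : Cof)
                       (g : [ ψ ] → (i : 𝕀) → Glue φ A B f (p i)) (a : Glue φ A B f (p ⟨ e ⟩))
                       (h : (v : [ ψ ]) → g v ⟨ e ⟩ ≡ a) where

      γ₁ : Γ
      γ₁ = p ⟨ not e ⟩

      φ-along : Cof
      φ-along = cof∀ (λ k → φ (p k))

      along : [ φ-along ] → (k : 𝕀) → [ φ (p k) ]
      along = cof∀-out (λ k → φ (p k))

      module OverA (w : (k : 𝕀) → [ φ (p k) ]) =
        Filling {C = λ k → A (p k) (w k)}
                (reindex {A = λ x → A (proj₁ x) (proj₂ x)} αA (λ k → p k , w k)) e ψ
                (λ v k → proj₁ (g v k) (w k)) (proj₁ a (w ⟨ e ⟩))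
                (λ v → cong (λ y → proj₁ y (w ⟨ e ⟩)) (h v))

      module TubeB = Join (λ v k → unglue (g v k)) (λ d k → f (p k) (along d k) (OverA.fill (along d) k))
        (λ v d → funext (λ k → trans (sym (unglue-on-φ (g v k) (along d k)))
                                     (cong (f (p k) (along d k)) (OverA.fill-agree (along d) v k))))

      compB : Σ (B γ₁) (λ b → (w : [ ψ ∨ φ-along ]) → TubeB.join w ⟨ not e ⟩ ≡ b)
      compB = αB p e (ψ ∨ φ-along) TubeB.join (unglue a) (TubeB.join-≡ (λ q → q ⟨ e ⟩)
        (λ v → cong unglue (h v))
        (λ d → trans (cong (f (p ⟨ e ⟩) (along d ⟨ e ⟩)) (OverA.fill-e (along d)))
                     (unglue-on-φ a (along d ⟨ e ⟩))))

      b₀ : B γ₁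
      b₀ = proj₁ compB

      b₀-on-ψ : (v : [ ψ ]) → unglue (g v ⟨ not e ⟩) ≡ b₀
      b₀-on-ψ = TubeB.restrictˡ (λ q → q ⟨ not e ⟩) (proj₂ compB)

      b₀-on-φ : (d : [ φ-along ]) → f γ₁ (along d ⟨ not e ⟩) (OverA.fill (along d) ⟨ not e ⟩) ≡ b₀
      b₀-on-φ = TubeB.restrictʳ (λ q → q ⟨ not e ⟩) (proj₂ compB)

      module AtFace (u : [ φ γ₁ ]) where
        transport : {u' : [ φ γ₁ ]} → A γ₁ u' → A γ₁ u
        transport {u'} = subst (A γ₁) ([ φ γ₁ ]-prop u' u)

        from-ψ : [ ψ ] → Fiber (f γ₁ u) b₀
        from-ψ v = const-fiber (proj₁ (g v ⟨ not e ⟩) u)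
          (trans (sym (b₀-on-ψ v)) (sym (unglue-on-φ (g v ⟨ not e ⟩) u)))

        from-φ : [ φ-along ] → Fiber (f γ₁ u) b₀
        from-φ d = const-fiber (transport compA) (begin
          b₀
            ≡⟨ sym (b₀-on-φ d) ⟩
          f γ₁ (along d ⟨ not e ⟩) (OverA.fill (along d) ⟨ not e ⟩)
            ≡⟨ cong (f γ₁ _) (OverA.fill-not-e (along d)) ⟩
          f γ₁ (along d ⟨ not e ⟩) compA
            ≡⟨ dcong₂ (f γ₁) ([ φ γ₁ ]-prop _ u) refl ⟩
          f γ₁ u (transport compA) ∎)
          where
            open ≡-Reasoning
            compA : A γ₁ (along d ⟨ not e ⟩)
            compA = proj₁ (OverA.comp (along d))

        module Lids = Join from-ψ from-φ (λ v d → Fiber-≡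
          (trans (sym (dcong (proj₁ (g v ⟨ not e ⟩)) ([ φ γ₁ ]-prop (along d ⟨ not e ⟩) u)))
                 (cong transport (proj₂ (OverA.comp (along d)) v)))
          refl)

        extension : Σ (Fiber (f γ₁ u) b₀) (λ x → (w : [ ψ ∨ φ-along ]) → Lids.join w ≡ x)
        extension = isContr→extension (f-equiv γ₁ u b₀)
          (fiber-comp (f γ₁ u) b₀ (αA (λ _ → γ₁ , u)) (αB (λ _ → γ₁)))
          (ψ ∨ φ-along) Lids.join

        a₁ : A γ₁ u
        a₁ = proj₁ (proj₁ extension)

        b₀⇝fa₁ : Path (B γ₁) b₀ (f γ₁ u a₁)
        b₀⇝fa₁ = proj₂ (proj₁ extension)

        extension-on-ψ : (v : [ ψ ]) → from-ψ v ≡ proj₁ extension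
        extension-on-ψ = Lids.restrictˡ id (proj₂ extension)

        extension-on-φ : (d : [ φ-along ]) → from-φ d ≡ proj₁ extension
        extension-on-φ = Lids.restrictʳ id (proj₂ extension)

      module TubeFinal = Join (λ u → proj₁ (AtFace.b₀⇝fa₁ u)) (λ v _ → unglue (g v ⟨ not e ⟩))
        (λ u v → trans (cong (λ x → proj₁ (proj₂ x)) (sym (AtFace.extension-on-ψ u v)))
                       (funext (λ _ → sym (b₀-on-ψ v))))

      compFinal : Σ (B γ₁) (λ b → (w : [ φ γ₁ ∨ ψ ]) → TubeFinal.join w I1 ≡ b)
      compFinal = αB (λ _ → γ₁) false (φ γ₁ ∨ ψ) TubeFinal.join b₀
        (TubeFinal.join-≡ (λ q → q O) (λ u → proj₁ (proj₂ (AtFace.b₀⇝fa₁ u))) b₀-on-ψ)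

      result : Glue φ A B f γ₁
      result = AtFace.a₁ , proj₁ compFinal ,
        λ u → trans (sym (proj₂ (proj₂ (AtFace.b₀⇝fa₁ u))))
                    (TubeFinal.restrictˡ (λ q → q I1) (proj₂ compFinal) u)

      result-extends : (v : [ ψ ]) → g v ⟨ not e ⟩ ≡ result
      result-extends v = Glue-≡ (funext (λ u → cong proj₁ (AtFace.extension-on-ψ u v)))
                                (TubeFinal.restrictʳ (λ q → q I1) (proj₂ compFinal) v)

      result-on-φ : (w : (k : 𝕀) → [ φ (p k) ]) → AtFace.a₁ (w ⟨ not e ⟩) ≡ proj₁ (OverA.comp w)
      result-on-φ w = trans (cong proj₁ (sym (AtFace.extension-on-φ (w ⟨ not e ⟩) d)))
        (subst-dcong (A γ₁) (λ w' → w' ⟨ not e ⟩) (λ w' → proj₁ (OverA.comp w'))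
                     (funext (λ k → [ φ (p k) ]-prop _ _)) _)
        where
          d : [ φ-along ]
          d = cof∀-in (λ k → φ (p k)) w

    Glue-fib : Fib (Glue φ A B f)
    Glue-fib p e ψ g a h = result , result-extends
      where open Composition p e ψ g a h

    Glue-fib-preserves : Preserves φ A B f Glue-fib αA
    Glue-fib-preserves p e ψ g a h = result-on-φ (λ k → proj₂ (p k))
      where open Composition (λ k → proj₁ (p k)) e ψ g a h

proposition3p8 : (𝓜 : Model) → let open Internal 𝓜 in
    {Γ : Set} (φ : Γ → Cof) (A : (γ : Γ) → [ φ γ ] → Set) (B : Γ → Set)
    (f : (γ : Γ) (u : [ φ γ ]) → A γ u → B γ) →
    (αA : Fib {Σ Γ (λ γ → [ φ γ ])} (λ x → A (proj₁ x) (proj₂ x))) →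
    (αB : Fib B) →
    ((γ : Γ) (u : [ φ γ ]) → isEquiv (f γ u)) →
    Σ (Fib (Glue φ A B f)) (λ αG → Preserves φ A B f αG αA)
proposition3p8 𝓜 φ A B f αA αB f-equiv = Glue-fib , Glue-fib-preserves
  where open GlueFibrancy.GlueFib 𝓜 φ A B f αA αB f-equiv
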